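{- Let $G$ be a finite simple graph on $n$ nodes, and let $G+v$ denote the graph obtained from $G$ by adding a new node $v\notin V(G)$ together with an edge from $v$ to every node of $G$. Then \[\mathrm{C}(G+v;x)=\mathrm{C}(G;x)+x(x+1)^n.\]
   Context: For a finite simple undirected graph $G$ with $n$ nodes, a connected set of $G$ is a nonempty subset of nodes inducing a connected subgraph, and $c_k$ denotes the number of connected sets of $G$ of order $k$. The connected set polynomial of $G$ is $\mathrm{C}(G;x)=\sum_{k=1}^n c_k x^k$. -}

module Defs where

open import Data.Nat using (ℕ; zero; suc; _+_)
open import Data.Bool using (Bool; true; false)
open import Data.Fin using (Fin; zero; suc)
open import Data.Fin.Subset using (Subset; _∈_; ∣_∣)
open import Data.List using (List; length)
import Data.List.Membership.Propositional as L
open import Data.List.Relation.Unary.Unique.Propositional using (Unique)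
open import Data.Product using (Σ; ∃; _×_)
open import Function.Bundles using (_⇔_)
open import Relation.Binary.PropositionalEquality using (_≡_)

record Graph (n : ℕ) : Set where
  field
    adj    : Fin n → Fin n → Bool
    sym    : ∀ i j → adj i j ≡ adj j i
    irrefl : ∀ i → adj i i ≡ false
open Graph public

-- G + v : new node (index zero), adjacent to every old node (indices suc i).
coneAdj : ∀ {n} → Graph n → Fin (suc n) → Fin (suc n) → Bool
coneAdj G zero    zero    = false
coneAdj G zero    (suc j) = true
coneAdj G (suc i) zero    = true
coneAdj G (suc i) (suc j) = adj G i j

coneSym : ∀ {n} (G : Graph n) i j → coneAdj G i j ≡ coneAdj G j i
coneSym G zero    zero    = Relation.Binary.PropositionalEquality.refl
coneSym G zero    (suc j) = Relation.Binary.PropositionalEquality.refl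
coneSym G (suc i) zero    = Relation.Binary.PropositionalEquality.refl
coneSym G (suc i) (suc j) = sym G i j

coneIrrefl : ∀ {n} (G : Graph n) i → coneAdj G i i ≡ false
coneIrrefl G zero    = Relation.Binary.PropositionalEquality.refl
coneIrrefl G (suc i) = irrefl G i

_+v : ∀ {n} → Graph n → Graph (suc n)
G +v = record { adj = coneAdj G ; sym = coneSym G ; irrefl = coneIrrefl G }

data WalkIn {n} (G : Graph n) (S : Subset n) : Fin n → Fin n → Set where
  here : ∀ {i} → i ∈ S → WalkIn G S i i
  step : ∀ {i k j} → i ∈ S → adj G i k ≡ true → WalkIn G S k j → WalkIn G S i j

InducesConnected : ∀ {n} → Graph n → Subset n → Set
InducesConnected G S = ∀ i j → i ∈ S → j ∈ S → WalkIn G S i j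

ConnectedSet : ∀ {n} → Graph n → Subset n → Set
ConnectedSet G S = (∃ λ i → i ∈ S) × InducesConnected G S

ConnectedSetOfOrder : ∀ {n} → Graph n → ℕ → Subset n → Set
ConnectedSetOfOrder G k S = ConnectedSet G S × ∣ S ∣ ≡ k

NumberOf : ∀ {n} → (Subset n → Set) → ℕ → Set
NumberOf {n} P m =
  Σ (List (Subset n)) λ xs → Unique xs × length xs ≡ m × (∀ S → (S L.∈ xs) ⇔ P S)

-- Polynomials with ℕ coefficients, as coefficient sequences (coefficient of x^k).
Poly : Set
Poly = ℕ → ℕ

_⊕_ : Poly → Poly → Poly
(p ⊕ q) k = p k + q k

xTimes : Poly → Poly
xTimes p zero    = 0
xTimes p (suc k) = p k

one : Poly
one zero    = 1
one (suc k) = 0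

x+1^ : ℕ → Poly
x+1^ zero    = one
x+1^ (suc n) = x+1^ n ⊕ xTimes (x+1^ n)

-- c is the coefficient sequence of the connected set polynomial C(G;x):
-- c k = number of connected sets of order k (c 0 = 0 automatically).
IsConnSetPoly : ∀ {n} → Graph n → Poly → Set
IsConnSetPoly G c = ∀ k → NumberOf (ConnectedSetOfOrder G k) (c k)

-- Split the connected sets of G + v according to whether they contain v.  Those
-- avoiding v are exactly the connected sets of G, since no walk inside them can
-- pass through v.  Those containing v are all connected, because v is adjacent to
-- every other node; so there are as many of order k + 1 as subsets of V(G) of
-- order k, which is the coefficient of x^(k+1) in x(x+1)^n.
module Submission where

open import Defs
open import Data.Nat using (ℕ; zero; suc; _+_)
open import Data.Nat.Properties using (suc-injective)
open import Data.Bool using (Bool; true; false)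
open import Data.Fin using (zero; suc)
open import Data.Fin.Subset using (Subset; ∣_∣; _∈_; _∉_)
open import Data.Vec using ([]; _∷_; here; there)
open import Data.List using ([]; _∷_; map; _++_; length)
open import Data.List.Properties using (length-++; length-map)
import Data.List.Membership.Propositional as List
open import Data.List.Membership.Propositional.Properties
  using (∈-map⁺; ∈-map⁻; ∈-++⁺ˡ; ∈-++⁺ʳ; ∈-++⁻)
open import Data.List.Membership.Propositional.Properties.WithK using (unique∧set⇒bag)
open import Data.List.Relation.Binary.BagAndSetEquality using (∼bag⇒↭)
open import Data.List.Relation.Binary.Permutation.Propositional.Properties using (↭-length)
open import Data.List.Relation.Unary.Any using (here)
open import Data.List.Relation.Unary.AllPairs using ([]; _∷_)
open import Data.List.Relation.Unary.All using ([])
open import Data.List.Relation.Unary.Unique.Propositional using (Unique)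
import Data.List.Relation.Unary.Unique.Propositional.Properties as Unique
open import Data.Product using (_×_; _,_; proj₂)
open import Data.Sum using (inj₁; inj₂)
open import Data.Empty using (⊥; ⊥-elim)
open import Function.Bundles using (_⇔_; mk⇔; Equivalence)
open import Function.Construct.Composition using (_⇔-∘_)
open import Function.Construct.Symmetry using (⇔-sym)
open import Relation.Binary.PropositionalEquality using (_≡_; refl; cong; cong₂; trans)

open Equivalence using (to; from)

NumberOf-unique : ∀ {n} {P : Subset n → Set} {a b} → NumberOf P a → NumberOf P b → a ≡ b
NumberOf-unique (xs , xs-unique , refl , xs-enum) (ys , ys-unique , refl , ys-enum) =
  ↭-length (∼bag⇒↭ (unique∧set⇒bag xs-unique ys-unique
    λ {S} → ⇔-sym (ys-enum S) ⇔-∘ xs-enum S))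

NumberOf-resp : ∀ {n} {P Q : Subset n → Set} {m} →
                NumberOf P m → (∀ S → P S ⇔ Q S) → NumberOf Q m
NumberOf-resp (xs , xs-unique , len , xs-enum) P⇔Q =
  xs , xs-unique , len , λ S → P⇔Q S ⇔-∘ xs-enum S

NumberOf-empty : ∀ {n} {P : Subset n → Set} → (∀ S → P S → ⊥) → NumberOf P 0
NumberOf-empty ¬P = [] , [] , refl , λ S → mk⇔ (λ ()) (λ p → ⊥-elim (¬P S p))

∷-injectiveʳ : ∀ {n} {b : Bool} {S T : Subset n} → b ∷ S ≡ b ∷ T → S ≡ T
∷-injectiveʳ refl = refl

NumberOf-byHead : ∀ {n} {P : Subset (suc n) → Set} {a b} →
                  NumberOf (λ S → P (false ∷ S)) a → NumberOf (λ S → P (true ∷ S)) b →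
                  NumberOf P (a + b)
NumberOf-byHead {P = P} (xs , xs-unique , refl , xs-enum) (ys , ys-unique , refl , ys-enum) =
  outs ++ ins , unique , length-outs++ins , λ S → mk⇔ (sound S) (complete S)
  where
  outs = map (false ∷_) xs
  ins  = map (true ∷_) ys

  disjoint : ∀ {S} → S List.∈ outs × S List.∈ ins → ⊥
  disjoint (p , q) with ∈-map⁻ (false ∷_) p | ∈-map⁻ (true ∷_) q
  ... | _ , _ , refl | _ , _ , ()

  unique : Unique (outs ++ ins)
  unique = Unique.++⁺ (Unique.map⁺ ∷-injectiveʳ xs-unique)
                      (Unique.map⁺ ∷-injectiveʳ ys-unique) disjoint

  length-outs++ins : length (outs ++ ins) ≡ length xs + length ys
  length-outs++ins = trans (length-++ outs) (cong₂ _+_ (length-map _ xs) (length-map _ ys))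

  sound : ∀ S → S List.∈ outs ++ ins → P S
  sound S S∈ with ∈-++⁻ outs S∈
  ... | inj₁ S∈outs with ∈-map⁻ (false ∷_) S∈outs
  ...   | T , T∈xs , refl = to (xs-enum T) T∈xs
  sound S S∈ | inj₂ S∈ins with ∈-map⁻ (true ∷_) S∈ins
  ...   | T , T∈ys , refl = to (ys-enum T) T∈ys

  complete : ∀ S → P S → S List.∈ outs ++ ins
  complete (false ∷ T) p = ∈-++⁺ˡ (∈-map⁺ (false ∷_) (from (xs-enum T) p))
  complete (true ∷ T)  p = ∈-++⁺ʳ outs (∈-map⁺ (true ∷_) (from (ys-enum T) p))

NumberOf-size    : ∀ n k → NumberOf (λ (S : Subset n) → ∣ S ∣ ≡ k) (x+1^ n k)
NumberOf-sizeSuc : ∀ n k → NumberOf (λ (S : Subset n) → suc ∣ S ∣ ≡ k) (xTimes (x+1^ n) k)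

NumberOf-size zero zero    = [] ∷ [] , [] ∷ [] , refl , λ { [] → mk⇔ (λ _ → refl) (λ _ → here refl) }
NumberOf-size zero (suc k) = NumberOf-empty λ { [] () }
NumberOf-size (suc n) k    = NumberOf-byHead (NumberOf-size n k) (NumberOf-sizeSuc n k)

NumberOf-sizeSuc n zero    = NumberOf-empty λ _ ()
NumberOf-sizeSuc n (suc k) = NumberOf-resp (NumberOf-size n k) λ _ → mk⇔ (cong suc) suc-injective

WalkIn-start : ∀ {n} {G : Graph n} {S i j} → WalkIn G S i j → i ∈ S
WalkIn-start (here i∈S)     = i∈S
WalkIn-start (step i∈S _ _) = i∈S

coneNode∉ : ∀ {n} {S : Subset n} → zero ∉ false ∷ S
coneNode∉ ()

module _ {n} (G : Graph n) where

  WalkIn-lift : ∀ {S i j} → WalkIn G S i j → WalkIn (G +v) (false ∷ S) (suc i) (suc j)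
  WalkIn-lift (here i∈S)     = here (there i∈S)
  WalkIn-lift (step i∈S e w) = step (there i∈S) e (WalkIn-lift w)

  WalkIn-lower : ∀ {S i j} → WalkIn (G +v) (false ∷ S) (suc i) (suc j) → WalkIn G S i j
  WalkIn-lower (here (there i∈S))                 = here i∈S
  WalkIn-lower (step {k = suc _} (there i∈S) e w) = step i∈S e (WalkIn-lower w)
  WalkIn-lower (step {k = zero}  _ _ w)           = ⊥-elim (coneNode∉ (WalkIn-start w))

  ConnectedSet-avoidingCone : ∀ S → ConnectedSet (G +v) (false ∷ S) ⇔ ConnectedSet G S
  ConnectedSet-avoidingCone S = mk⇔ lower lift
    where
    lower : ConnectedSet (G +v) (false ∷ S) → ConnectedSet G S
    lower ((suc i , there i∈S) , conn) =
      (i , i∈S) , λ a b a∈S b∈S → WalkIn-lower (conn (suc a) (suc b) (there a∈S) (there b∈S))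

    lift : ConnectedSet G S → ConnectedSet (G +v) (false ∷ S)
    lift ((i , i∈S) , conn) = (suc i , there i∈S) , conn⁺
      where
      conn⁺ : InducesConnected (G +v) (false ∷ S)
      conn⁺ (suc a) (suc b) (there a∈S) (there b∈S) = WalkIn-lift (conn a b a∈S b∈S)

  WalkIn-fromCone : ∀ {S} j → j ∈ true ∷ S → WalkIn (G +v) (true ∷ S) zero j
  WalkIn-fromCone zero    _   = here here
  WalkIn-fromCone (suc j) j∈  = step here refl (here j∈)

  ConnectedSet-containingCone : ∀ S → ConnectedSet (G +v) (true ∷ S)
  ConnectedSet-containingCone S = (zero , here) , conn
    where
    conn : InducesConnected (G +v) (true ∷ S)
    conn zero    b _   b∈ = WalkIn-fromCone b b∈
    conn (suc a) b a∈S b∈ = step a∈S refl (WalkIn-fromCone b b∈)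

lemma11 : (n : ℕ) (G : Graph n) (cG cGv : Poly) →
          IsConnSetPoly G cG → IsConnSetPoly (G +v) cGv →
          ∀ k → cGv k ≡ (cG ⊕ xTimes (x+1^ n)) k
lemma11 n G cG cGv countG countG+v k =
  NumberOf-unique (countG+v k) (NumberOf-byHead avoidingCone containingCone)
  where
  avoidingCone : NumberOf (λ S → ConnectedSetOfOrder (G +v) k (false ∷ S)) (cG k)
  avoidingCone = NumberOf-resp (countG k) λ S →
    let G⇔G+v = ConnectedSet-avoidingCone G S
    in mk⇔ (λ (c , o) → from G⇔G+v c , o) (λ (c , o) → to G⇔G+v c , o)

  containingCone : NumberOf (λ S → ConnectedSetOfOrder (G +v) k (true ∷ S)) (xTimes (x+1^ n) k)
  containingCone = NumberOf-resp (NumberOf-sizeSuc n k) λ S →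
    mk⇔ (λ size → ConnectedSet-containingCone G S , size) proj₂
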